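{- Let $G$ be a strongly connected directed graph with $n$ nodes that is not a cycle. Then $G$ has at most $O(n)$ maximal safe walks that are interleaved.
   Context: "$G$ is a cycle" means $G$ consists of a single directed cycle through all its nodes. A walk is a sequence of nodes with consecutive pairs being arcs; closed if first and last node coincide. Subwalks are contiguous subsequences (for closed walks they may wrap around the end). A walk is safe if it is a subwalk of every closed walk of $G$ containing all nodes of $G$; it is a maximal safe walk if it is not a proper subwalk of another safe walk. A split is a node with at least two outgoing arcs; a join is a node with at least two incoming arcs. For $W=(w_1,\dots,w_\ell)$, $\ell\ge2$, with inner nodes $w_2,\dots,w_{\ell-1}$, let $w_i$ be the first inner join (or $w_\ell$ if none) and $w_j$ the last inner split (or $w_1$ if none); $W$ is interleaved if $i\le j+1$. -}

module Defs where

open import Data.Nat using (ℕ; zero; suc; _+_; _*_; _∸_; _≤_; _<_)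
open import Data.Bool using (Bool; true; false; if_then_else_)
open import Data.Fin using (Fin)
open import Data.Fin.Properties using (_≟_)
open import Data.List using (List; []; _∷_; _++_; length; allFin; concat; replicate; take; drop; filter; zip)
open import Data.List.Membership.Propositional using (_∈_)
open import Data.List.Relation.Binary.Permutation.Propositional using (_↭_)
open import Data.Product using (_×_; _,_; proj₁; proj₂; ∃; ∃-syntax)
open import Data.Unit using (⊤)
open import Data.Empty using (⊥)
open import Relation.Nullary using (¬_)
open import Relation.Nullary.Decidable using (⌊_⌋)
open import Relation.Binary.PropositionalEquality using (_≡_; _≢_)

-- A directed (multi)graph on the node set Fin n, given by its list of arcs
-- (a list, so parallel arcs and self-loops are allowed).
Graph : ℕ → Set
Graph n = List (Fin n × Fin n)

module _ {n : ℕ} (G : Graph n) where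

  IsWalk : List (Fin n) → Set
  IsWalk []           = ⊥
  IsWalk (x ∷ [])     = ⊤
  IsWalk (x ∷ y ∷ xs) = ((x , y) ∈ G) × IsWalk (y ∷ xs)

  lastOr : Fin n → List (Fin n) → Fin n
  lastOr d []       = d
  lastOr d (x ∷ xs) = lastOr x xs

  Reach : Fin n → Fin n → Set
  Reach u v = ∃[ xs ] (IsWalk (u ∷ xs) × lastOr u xs ≡ v)

  StronglyConnected : Set
  StronglyConnected = ∀ u v → Reach u v

  rotate : List (Fin n) → List (Fin n)
  rotate []       = []
  rotate (x ∷ xs) = xs ++ (x ∷ [])

  -- G consists of a single directed cycle through all its nodes:
  -- an ordering c of all nodes (each exactly once) such that the arcs of G
  -- are exactly (as a multiset) the arcs c_i → c_{i+1} and c_k → c_1.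
  IsCycle : Set
  IsCycle = ∃[ c ] ((c ↭ allFin n) × (G ↭ zip c (rotate c)))

  IsClosedWalk : List (Fin n) → Set
  IsClosedWalk []       = ⊥
  IsClosedWalk (c ∷ cs) = IsWalk (c ∷ cs) × (cs ≢ []) × (lastOr c cs ≡ c)

  Covering : List (Fin n) → Set
  Covering C = ∀ v → v ∈ C

  Subwalk : List (Fin n) → List (Fin n) → Set
  Subwalk W W' = ∃[ xs ] ∃[ ys ] (xs ++ W ++ ys ≡ W')

  -- subwalk of a closed walk C = (c₁ … c_m), c₁ = c_m: a contiguous
  -- subsequence of the cyclic traversal of C, possibly wrapping around the end
  -- (any number of times): an infix of (c₁ … c_{m-1})^k for some k.
  ClosedSubwalk : List (Fin n) → List (Fin n) → Set
  ClosedSubwalk W C =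
    ∃[ k ] Subwalk W (concat (replicate k (take (length C ∸ 1) C)))

  IsSafe : List (Fin n) → Set
  IsSafe W = IsWalk W ×
    (∀ C → IsClosedWalk C → Covering C → ClosedSubwalk W C)

  IsMaximalSafe : List (Fin n) → Set
  IsMaximalSafe W = IsSafe W ×
    (∀ W' → IsSafe W' → Subwalk W W' → W ≡ W')

  outdeg indeg : Fin n → ℕ
  outdeg v = length (filter (λ a → proj₁ a ≟ v) G)
  indeg  v = length (filter (λ a → proj₂ a ≟ v) G)

  isSplit isJoin : Fin n → Bool
  isSplit v = ⌊ 2 Data.Nat.≤? outdeg v ⌋
  isJoin  v = ⌊ 2 Data.Nat.≤? indeg v ⌋

  findFirst : (Fin n → Bool) → ℕ → List (Fin n) → ℕ → ℕ
  findFirst p k []       d = d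
  findFirst p k (x ∷ xs) d = if p x then k else findFirst p (suc k) xs d

  findLast : (Fin n → Bool) → ℕ → List (Fin n) → ℕ → ℕ
  findLast p k []       d = d
  findLast p k (x ∷ xs) d = findLast p (suc k) xs (if p x then k else d)

  -- W = (w₁ … w_ℓ), ℓ ≥ 2; inner nodes w₂ … w_{ℓ-1} (1-based positions)
  innerNodes : List (Fin n) → List (Fin n)
  innerNodes W = take (length W ∸ 2) (drop 1 W)

  -- i = position of first inner join (ℓ if none),
  -- j = position of last inner split (1 if none); interleaved iff i ≤ j + 1
  IsInterleaved : List (Fin n) → Set
  IsInterleaved W =
    (2 ≤ length W) ×
    (findFirst isJoin 2 (innerNodes W) (length W)
       ≤ suc (findLast isSplit 2 (innerNodes W) 1))

-- Cut a maximal safe walk W with at least one arc at its key arc (a, b), where b is the first node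
-- after the start of W with two distinct predecessors (or the last node) and a precedes b.  The key
-- determines W.  Up to b, W runs backwards through nodes with a unique predecessor, so of two such
-- walks one is a suffix of the other, and a proper suffix could be extended to the left, against
-- maximality.  After b, if two such walks diverged at y ≠ y′, let b₂ be the last node with two
-- predecessors before the divergence and a₂ its predecessor: a₂ b₂ N y and a₂ b₂ N y′ would both be
-- safe, yet a covering closed walk made of loops at b₂ avoids one of them.  Finally the key arc uv is
-- safe, and for a fixed root r a safe arc lies on all walks from r to some node (then v determines u)
-- or on all walks from some node to r (then u determines v); so there are at most 2n keys.
module Submission where

open import Defs
open import Data.Nat using (ℕ; zero; suc; _*_; _∸_; _≤_; z≤n; s≤s; _≤?_)
open import Data.Nat.Properties using (≮⇒≥; 1+n≢n; ≤-trans)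
open import Data.Fin using (Fin; zero; suc; combine; _<_)
open import Data.Fin.Properties using (_≟_; pigeonhole; combine-injective)
import Data.Fin.Properties as Fin
open import Data.List
  using (List; []; _∷_; _++_; _∷ʳ_; length; concat; replicate; take; allFin; map; filter; reverse; lookup)
open import Data.List.Properties
  using (++-assoc; ++-identityʳ; ∷-injective; ∷-injectiveˡ; ∷-injectiveʳ; ∷ʳ-injectiveˡ; ∷ʳ-injectiveʳ;
         ∷ʳ-++; ++-cancelˡ; ++-conicalˡ; ++-conicalʳ; concat-++; map-++; map-replicate;
         reverse-++; reverse-involutive; reverse-injective; unfold-reverse)
open import Data.List.Membership.Propositional using (_∈_; _∉_; find)
open import Data.List.Membership.Propositional.Properties
  using (∈-allFin; ∈-lookup; ∈-++⁺ˡ; ∈-++⁺ʳ; ∈-++⁻; ∈-map⁺; ∈-concat⁺′;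
         ∈-map∘filter⁺; ∈-map∘filter⁻)
open import Data.List.Relation.Unary.Any using (here; there)
open import Data.List.Relation.Unary.All using (All; []; _∷_; all?)
import Data.List.Relation.Unary.All as All
open import Data.List.Relation.Unary.All.Properties using (¬All⇒Any¬)
import Data.List.Relation.Unary.All.Properties as All
open import Data.List.Relation.Unary.AllPairs using ([]; _∷_)
open import Data.List.Relation.Unary.Linked using (Linked; []; [-]; _∷_)
import Data.List.Relation.Unary.Linked as Linked
open import Data.List.Relation.Unary.Unique.Propositional using (Unique)
open import Data.Product using (_×_; _,_; proj₁; proj₂; ∃; ∃-syntax; Σ; map₂)
open import Data.Sum using (_⊎_; inj₁; inj₂; [_,_]′)
open import Data.Unit using (⊤; tt)
open import Data.Empty using (⊥; ⊥-elim)
open import Effect.Applicative using (RawApplicative)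
open import Effect.Monad using (RawMonad)
open import Function using (_∘_; _∋_; id)
open import Level using (0ℓ)
open import Relation.Binary using (Rel; DecidableEquality)
open import Relation.Nullary using (¬_; Dec; yes; no)
open import Relation.Nullary.Decidable using (decidable-stable)
open import Relation.Nullary.Negation using (¬¬-Monad; ¬¬-map)
open import Relation.Nullary.Negation.Core using (DoubleNegation)
open import Relation.Binary.PropositionalEquality
  using (_≡_; _≢_; refl; sym; trans; cong; cong₂; subst; module ≡-Reasoning)

private
  variable
    A : Set

  ¬¬-applicative : RawApplicative (DoubleNegation {0ℓ})
  ¬¬-applicative = RawMonad.rawApplicative ¬¬-Monad

++-≡-++⁻ : (ws xs ys zs : List A) → ws ++ xs ≡ ys ++ zs →
           (∃[ ms ] (ws ≡ ys ++ ms × ms ++ xs ≡ zs)) ⊎ (∃[ ms ] (ys ≡ ws ++ ms × xs ≡ ms ++ zs))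
++-≡-++⁻ ws       xs []       zs eq = inj₁ (ws , refl , eq)
++-≡-++⁻ []       xs (y ∷ ys) zs eq = inj₂ (y ∷ ys , refl , eq)
++-≡-++⁻ (w ∷ ws) xs (y ∷ ys) zs eq with ∷-injective eq
... | refl , eq′ with ++-≡-++⁻ ws xs ys zs eq′
...   | inj₁ (ms , e₁ , e₂) = inj₁ (ms , cong (w ∷_) e₁ , e₂)
...   | inj₂ (ms , e₁ , e₂) = inj₂ (ms , cong (w ∷_) e₁ , e₂)

∈-init : ∀ (xs : List A) {b R} L {w} → xs ++ b ∷ R ≡ L ∷ʳ w → R ≢ [] → b ∈ L
∈-init []          []      eq R≢[] = ⊥-elim (R≢[] (∷-injectiveʳ eq))
∈-init []          (l ∷ L) eq _    = here (∷-injectiveˡ eq)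
∈-init (x ∷ [])    []      ()
∈-init (x ∷ _ ∷ _) []      ()
∈-init (x ∷ xs)    (l ∷ L) eq R≢[] = there (∈-init xs L (∷-injectiveʳ eq) R≢[])

∈-after : ∀ {x : A} {xs} B {y z zs} → x ∷ xs ≡ B ++ y ∷ z ∷ zs → z ∈ xs
∈-after []      refl = here refl
∈-after (_ ∷ B) refl = ∈-++⁺ʳ B (there (here refl))

prefix-head : ∀ {x : A} {xs} D {y E} → x ∷ xs ≡ D ++ y ∷ E → ∃[ ys ] (x ∷ ys ≡ D ∷ʳ y)
prefix-head []      eq = [] , cong (_∷ []) (∷-injectiveˡ eq)
prefix-head (d ∷ D) eq = D ∷ʳ _ , cong (_∷ D ∷ʳ _) (∷-injectiveˡ eq)

∷ʳ≢[] : ∀ (xs : List A) {y} → xs ∷ʳ y ≢ []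
∷ʳ≢[] xs = (λ ()) ∘ ++-conicalʳ xs _

≢-cons-self : ∀ {x : A} xs → xs ≢ x ∷ xs
≢-cons-self xs = 1+n≢n ∘ sym ∘ cong length

take-init : ∀ (xs : List A) {y} → take (length (xs ∷ʳ y) ∸ 1) (xs ∷ʳ y) ≡ xs
take-init []            = refl
take-init (x ∷ [])      = refl
take-init (x ∷ x′ ∷ xs) = cong (x ∷_) (take-init (x′ ∷ xs))

repeat : List A → ℕ → List A
repeat S k = concat (replicate k S)

split-at-last : {P Q : A → Set} → (∀ x → P x ⊎ Q x) → (xs : List A) →
  (∃[ D ] ∃[ x ] ∃[ N ] (xs ≡ D ++ x ∷ N × P x × All Q N)) ⊎ All Q xs
split-at-last P⊎Q []       = inj₂ []
split-at-last P⊎Q (x ∷ xs) with split-at-last P⊎Q xs | P⊎Q x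
... | inj₁ (D , y , N , refl , py , qN) | _       = inj₁ (x ∷ D , y , N , refl , py , qN)
... | inj₂ qxs                          | inj₁ px = inj₁ ([] , x , xs , refl , px , qxs)
... | inj₂ qxs                          | inj₂ qx = inj₂ (qx ∷ qxs)

module _ (_≟ᴬ_ : DecidableEquality A) where

  first-occurrence : ∀ x (xs : List A) → x ∈ xs → ∃[ D ] ∃[ E ] (xs ≡ D ++ x ∷ E × x ∉ D)
  first-occurrence x (y ∷ xs) x∈ with y ≟ᴬ x
  ... | yes refl = [] , xs , refl , λ ()
  first-occurrence x (y ∷ xs) (here x≡y) | no y≢x = ⊥-elim (y≢x (sym x≡y))
  first-occurrence x (y ∷ xs) (there x∈) | no y≢x with first-occurrence x xs x∈
  ... | D , E , refl , x∉D =
    y ∷ D , E , refl , λ { (here x≡y) → y≢x (sym x≡y) ; (there x∈D) → x∉D x∈D }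

  prefix-or-diverge : (xs ys : List A) →
    (∃[ zs ] (xs ++ zs ≡ ys)) ⊎ (∃[ zs ] (ys ++ zs ≡ xs)) ⊎
    (∃[ Q ] ∃[ y ] ∃[ y′ ] ∃[ t ] ∃[ t′ ] (y ≢ y′ × xs ≡ Q ++ y ∷ t × ys ≡ Q ++ y′ ∷ t′))
  prefix-or-diverge []       ys       = inj₁ (ys , refl)
  prefix-or-diverge (x ∷ xs) []       = inj₂ (inj₁ (x ∷ xs , refl))
  prefix-or-diverge (x ∷ xs) (y ∷ ys) with x ≟ᴬ y
  ... | no x≢y = inj₂ (inj₂ ([] , x , y , xs , ys , x≢y , refl , refl))
  ... | yes refl with prefix-or-diverge xs ys
  ...   | inj₁ (zs , eq)        = inj₁ (zs , cong (x ∷_) eq)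
  ...   | inj₂ (inj₁ (zs , eq)) = inj₂ (inj₁ (zs , cong (x ∷_) eq))
  ...   | inj₂ (inj₂ (Q , z , z′ , t , t′ , z≢z′ , refl , refl)) =
          inj₂ (inj₂ (x ∷ Q , z , z′ , t , t′ , z≢z′ , refl , refl))

  all-equal-or-two-distinct : (xs : List A) →
    (∃[ p ] ∃[ q ] (p ∈ xs × q ∈ xs × p ≢ q)) ⊎ (∀ {p q} → p ∈ xs → q ∈ xs → p ≡ q)
  all-equal-or-two-distinct []       = inj₂ λ ()
  all-equal-or-two-distinct (x ∷ xs) with all? (x ≟ᴬ_) xs
  ... | yes all≡x = inj₂ λ p∈ q∈ → trans (≡x p∈) (sym (≡x q∈))
    where
    ≡x : ∀ {p} → p ∈ x ∷ xs → p ≡ x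
    ≡x (here p≡x) = p≡x
    ≡x (there p∈) = sym (All.lookup all≡x p∈)
  ... | no ¬all≡x with find (¬All⇒Any¬ (x ≟ᴬ_) xs ¬all≡x)
  ...   | q , q∈ , x≢q = inj₁ (x , q , here refl , there q∈ , x≢q)

module _ {ℓ} {R : Rel A ℓ} where

  Linked-++⁻ˡ : ∀ xs {ys} → Linked R (xs ++ ys) → Linked R xs
  Linked-++⁻ˡ []           _       = []
  Linked-++⁻ˡ (x ∷ [])     _       = [-]
  Linked-++⁻ˡ (x ∷ y ∷ xs) (r ∷ l) = r ∷ Linked-++⁻ˡ (y ∷ xs) l

  Linked-++⁻ʳ : ∀ xs {ys} → Linked R (xs ++ ys) → Linked R ys
  Linked-++⁻ʳ []       l = l
  Linked-++⁻ʳ (x ∷ xs) l = Linked-++⁻ʳ xs (Linked.tail l)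

  Linked-glue : ∀ xs {y ys} → Linked R (xs ∷ʳ y) → Linked R (y ∷ ys) → Linked R (xs ++ y ∷ ys)
  Linked-glue []            _       l = l
  Linked-glue (x ∷ [])      (r ∷ _) l = r ∷ l
  Linked-glue (x ∷ x′ ∷ xs) (r ∷ k) l = r ∷ Linked-glue (x′ ∷ xs) k l

unique-length≤ : ∀ {m} (xs : List (Fin m)) → Unique xs → length xs ≤ m
unique-length≤ {m} xs u = ≮⇒≥ λ m<len →
  let i , j , i<j , eq = pigeonhole m<len (lookup xs) in lookup-injective xs u i j i<j eq
  where
  lookup-injective : ∀ (xs : List (Fin m)) → Unique xs → ∀ i j → i < j → lookup xs i ≢ lookup xs j
  lookup-injective (x ∷ xs) (x∉ ∷ _) zero    (suc j) _         eq = All.lookup x∉ (∈-lookup j) eq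
  lookup-injective (x ∷ xs) (_ ∷ u)  (suc i) (suc j) (s≤s i<j) eq = lookup-injective xs u i j i<j eq

module _ {X : Set} {P : X → Set} {m} (code : ∀ {x} → P x → Fin m)
         (code-injective : ∀ {x y} (px : P x) (py : P y) → code px ≡ code py → x ≡ y) where

  private
    codes : ∀ {xs} → All P xs → List (Fin m)
    codes = All.reduce code

    length-codes : ∀ {xs} (ps : All P xs) → length (codes ps) ≡ length xs
    length-codes []       = refl
    length-codes (p ∷ ps) = cong suc (length-codes ps)

    unique-codes : ∀ {xs} → Unique xs → (ps : All P xs) → Unique (codes ps)
    unique-codes []       []       = []
    unique-codes (x∉ ∷ u) (p ∷ ps) = fresh x∉ ps ∷ unique-codes u ps
      where
      fresh : ∀ {x ys} {px : P x} → All (x ≢_) ys → (qs : All P ys) → All (code px ≢_) (codes qs)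
      fresh []         []       = []
      fresh (x≢y ∷ ne) (q ∷ qs) = (x≢y ∘ code-injective _ q) ∷ fresh ne qs

  length≤-by-injection : ∀ {xs} → Unique xs → All P xs → length xs ≤ m
  length≤-by-injection u ps = subst (_≤ m) (length-codes ps) (unique-length≤ (codes ps) (unique-codes u ps))

module _ {n : ℕ} (G : Graph n) where

  V : Set
  V = Fin n

  Arc : V → V → Set
  Arc u v = (u , v) ∈ G

  infix 4 _⊑_
  _⊑_ : List V → List V → Set
  W ⊑ xs = Subwalk G W xs

  Unavoidable : List V → Set
  Unavoidable W = ∀ C → IsClosedWalk G C → Covering G C → ClosedSubwalk G W C

  Path : V → V → List V → Set
  Path x y xs = Linked Arc (x ∷ xs) × lastOr G x xs ≡ y

  walk⇒linked : ∀ {W} → IsWalk G W → Linked Arc W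
  walk⇒linked {_ ∷ []}    _       = [-]
  walk⇒linked {_ ∷ _ ∷ _} (a , w) = a ∷ walk⇒linked w

  linked⇒walk : ∀ {x W} → Linked Arc (x ∷ W) → IsWalk G (x ∷ W)
  linked⇒walk [-]     = tt
  linked⇒walk (a ∷ l) = a , linked⇒walk l

  maximal⇒linked : ∀ {W} → IsMaximalSafe G W → Linked Arc W
  maximal⇒linked ((walk , _) , _) = walk⇒linked walk

  reach⇒path : StronglyConnected G → ∀ x y → ∃ (Path x y)
  reach⇒path sc x y = let xs , w , l = sc x y in xs , walk⇒linked w , l

  lastOr-∷ʳ : ∀ d xs {y} → lastOr G d (xs ∷ʳ y) ≡ y
  lastOr-∷ʳ d []       = refl
  lastOr-∷ʳ d (x ∷ xs) = lastOr-∷ʳ x xs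

  lastOr-++ : ∀ d xs ys → lastOr G d (xs ++ ys) ≡ lastOr G (lastOr G d xs) ys
  lastOr-++ d []       ys = refl
  lastOr-++ d (x ∷ xs) ys = lastOr-++ x xs ys

  lastOr-∈ : ∀ d xs → lastOr G d xs ∈ d ∷ xs
  lastOr-∈ d []       = here refl
  lastOr-∈ d (x ∷ xs) = there (lastOr-∈ x xs)

  ∷≡∷ʳ⇒lastOr : ∀ {x xs} ys {y} → x ∷ xs ≡ ys ∷ʳ y → lastOr G x xs ≡ y
  ∷≡∷ʳ⇒lastOr []       refl = refl
  ∷≡∷ʳ⇒lastOr (z ∷ zs) refl = lastOr-∷ʳ z zs

  init∷ʳlast : ∀ x xs → take (length (x ∷ xs) ∸ 1) (x ∷ xs) ∷ʳ lastOr G x xs ≡ x ∷ xs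
  init∷ʳlast x []       = refl
  init∷ʳlast x (y ∷ xs) = cong (x ∷_) (init∷ʳlast y xs)

  snoc-last : ∀ {x xs y} → lastOr G x xs ≡ y → ∃[ X ] (X ∷ʳ y ≡ x ∷ xs)
  snoc-last {x} {xs} refl = _ , init∷ʳlast x xs

  loop-view : ∀ {x xs} → xs ≢ [] → lastOr G x xs ≡ x → ∃[ β ] (x ∷ xs ≡ x ∷ β ∷ʳ x)
  loop-view {xs = []}     []≢[] _    = ⊥-elim ([]≢[] refl)
  loop-view {xs = y ∷ ys} _     last = let β , eq = snoc-last {y} {ys} last in β , cong (_ ∷_) (sym eq)

  Linked-++-path : ∀ x xs {ys} → Linked Arc (x ∷ xs) → Linked Arc (lastOr G x xs ∷ ys) →
    Linked Arc (x ∷ xs ++ ys)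
  Linked-++-path x []       _       l = l
  Linked-++-path x (y ∷ xs) (a ∷ k) l = a ∷ Linked-++-path y xs k l

  path-++ : ∀ {x y z xs ys} → Path x y xs → Path y z ys → Path x z (xs ++ ys)
  path-++ {x} {xs = xs} {ys} (k , refl) (l , refl) = Linked-++-path x xs k l , lastOr-++ x xs ys

  close-path : ∀ {x c xs} → Path x c xs → Arc c x → Linked Arc (x ∷ xs ∷ʳ x)
  close-path {x} {xs = xs} (l , refl) c→x = Linked-++-path x xs l (c→x ∷ [-])

  after-last-visit : ∀ x h xs → Linked Arc (h ∷ xs) →
    x ∉ xs ⊎ ∃[ σ ] (x ∉ σ × Linked Arc (x ∷ σ) × lastOr G x σ ≡ lastOr G h xs)
  after-last-visit x h []       _       = inj₁ λ ()
  after-last-visit x h (y ∷ ys) (_ ∷ l) with after-last-visit x y ys l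
  ... | inj₂ found = inj₂ found
  ... | inj₁ x∉ys with y ≟ x
  ...   | yes refl = inj₂ (ys , x∉ys , l , refl)
  ...   | no y≢x   = inj₁ λ { (here x≡y) → y≢x (sym x≡y) ; (there x∈ys) → x∉ys x∈ys }

  last-visit : ∀ {x y} xs → Path x y xs → ∃[ σ ] (x ∉ σ × Path x y σ)
  last-visit {x} xs (l , refl) with after-last-visit x x xs l
  ... | inj₁ x∉xs              = xs , x∉xs , l , refl
  ... | inj₂ (σ , x∉σ , k , e) = σ , x∉σ , k , e

  first-visit : ∀ {x y} xs → Path x y xs → ∃[ D ] ∃[ ys ] (y ∉ D × x ∷ ys ≡ D ∷ʳ y × Path x y ys)
  first-visit {x} {y} xs (l , last)
    with first-occurrence _≟_ y (x ∷ xs) (subst (_∈ x ∷ xs) last (lastOr-∈ x xs))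
  ... | D , E , eq , y∉D with prefix-head D eq
  ...   | ys , eq′ = D , ys , y∉D , eq′ , subst (Linked Arc) (sym eq′) linked-D , ∷≡∷ʳ⇒lastOr D eq′
    where
    linked-D : Linked Arc (D ∷ʳ y)
    linked-D = Linked-++⁻ˡ (D ∷ʳ y) (subst (Linked Arc) (trans eq (sym (∷ʳ-++ D y E))) l)

  return-loop : StronglyConnected G → ∀ {c x} → Arc c x → ∀ v →
    ∃[ L ] (x ∉ L × Linked Arc (x ∷ L ∷ʳ x) × v ∈ x ∷ L)
  return-loop sc {c} {x} c→x v with last-visit _ (proj₂ (reach⇒path sc x v)) | reach⇒path sc v c
  ... | σ , x∉σ , pσ | ys , pys with first-occurrence _≟_ x (ys ∷ʳ x) (∈-++⁺ʳ ys (here refl))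
  ...   | D , E , eq , x∉D =
    σ ++ D , x∉σD ,
    Linked-++⁻ˡ (x ∷ (σ ++ D) ∷ʳ x) (subst (Linked Arc) unfold (close-path (path-++ pσ pys) c→x)) ,
    ∈-++⁺ˡ (subst (_∈ x ∷ σ) (proj₂ pσ) (lastOr-∈ x σ))
    where
    open ≡-Reasoning
    x∉σD : x ∉ σ ++ D
    x∉σD x∈ with ∈-++⁻ σ x∈
    ... | inj₁ x∈σ = x∉σ x∈σ
    ... | inj₂ x∈D = x∉D x∈D
    unfold : x ∷ (σ ++ ys) ∷ʳ x ≡ (x ∷ (σ ++ D) ∷ʳ x) ++ E
    unfold = cong (x ∷_) (begin
      (σ ++ ys) ∷ʳ x        ≡⟨ ++-assoc σ ys _ ⟩
      σ ++ ys ∷ʳ x          ≡⟨ cong (σ ++_) eq ⟩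
      σ ++ D ++ x ∷ E       ≡⟨ ++-assoc σ D _ ⟨
      (σ ++ D) ++ x ∷ E     ≡⟨ ∷ʳ-++ (σ ++ D) x E ⟨
      (σ ++ D) ∷ʳ x ++ E    ∎)

  ⊑-trans : ∀ {U W xs} → U ⊑ W → W ⊑ xs → U ⊑ xs
  ⊑-trans {U} (p , s , refl) (p′ , s′ , refl) = p′ ++ p , s ++ s′ , (begin
    (p′ ++ p) ++ U ++ s ++ s′   ≡⟨ ++-assoc p′ p _ ⟩
    p′ ++ p ++ U ++ s ++ s′     ≡⟨ cong (λ Z → p′ ++ p ++ Z) (++-assoc U s s′) ⟨
    p′ ++ p ++ (U ++ s) ++ s′   ≡⟨ cong (p′ ++_) (++-assoc p (U ++ s) s′) ⟨
    p′ ++ (p ++ U ++ s) ++ s′   ∎)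
    where open ≡-Reasoning

  ⊑-++ʳ : ∀ {W xs} ys → W ⊑ xs → W ⊑ xs ++ ys
  ⊑-++ʳ {W} ys (p , s , refl) =
    p , s ++ ys , trans (cong (p ++_) (sym (++-assoc W s ys))) (sym (++-assoc p (W ++ s) ys))

  ¬⊑-singleton : ∀ {u w W x} → ¬ u ∷ w ∷ W ⊑ x ∷ []
  ¬⊑-singleton ([]    , _ , ())
  ¬⊑-singleton (_ ∷ p , s , eq) with ++-conicalʳ p _ (∷-injectiveʳ eq)
  ... | ()

  prefix? : (W xs : List V) → Dec (∃[ s ] (W ++ s ≡ xs))
  prefix? []      xs       = yes (xs , refl)
  prefix? (w ∷ W) []       = no λ ()
  prefix? (w ∷ W) (x ∷ xs) with w ≟ x | prefix? W xs
  ... | yes refl | yes (s , eq) = yes (s , cong (w ∷_) eq)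
  ... | yes refl | no ¬p        = no λ (s , eq) → ¬p (s , ∷-injectiveʳ eq)
  ... | no w≢x   | _            = no λ (_ , eq) → w≢x (∷-injectiveˡ eq)

  subwalk? : (W xs : List V) → Dec (W ⊑ xs)
  subwalk? W xs with prefix? W xs
  ... | yes (s , eq) = yes ([] , s , eq)
  subwalk? W []       | no ¬p = no λ { ([] , s , eq) → ¬p (s , eq) ; (_ ∷ _ , _ , ()) }
  subwalk? W (x ∷ xs) | no ¬p with subwalk? W xs
  ... | yes (p , s , eq) = yes (x ∷ p , s , cong (x ∷_) eq)
  ... | no ¬s            =
    no λ { ([] , s , eq) → ¬p (s , eq) ; (_ ∷ p , s , eq) → ¬s (p , s , ∷-injectiveʳ eq) }

  subwalk-split : ∀ {W} X x Y → W ⊑ X ++ x ∷ Y →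
    W ⊑ X ∷ʳ x ⊎ W ⊑ x ∷ Y ⊎
    ∃[ p ] ∃[ P ] ∃[ s ] ∃[ S ]
      (W ≡ p ∷ P ++ x ∷ s ∷ S × (∃[ X₀ ] X ≡ X₀ ++ p ∷ P) × (∃[ Y₀ ] Y ≡ s ∷ S ++ Y₀))
  subwalk-split {W} X x Y (pre , suf , eq) with ++-≡-++⁻ pre (W ++ suf) X (x ∷ Y) eq
  ... | inj₁ (ms , _ , eq′) = inj₂ (inj₁ (ms , suf , eq′))
  ... | inj₂ (ms , refl , eq′) with ++-≡-++⁻ W suf ms (x ∷ Y) eq′
  ...   | inj₂ (ks , refl , refl) =
          inj₁ (pre , ks ∷ʳ x , sym (trans (++-assoc pre (W ++ ks) _) (cong (pre ++_) (++-assoc W ks _))))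
  ...   | inj₁ ([] , refl , refl) =
          inj₁ (pre , x ∷ [] ,
                trans (cong (λ Z → pre ++ Z ++ x ∷ []) (++-identityʳ ms)) (sym (++-assoc pre ms _)))
  ...   | inj₁ (_ ∷ [] , refl , refl) =
          inj₁ (pre , [] , trans (cong (pre ++_) (++-identityʳ (ms ∷ʳ x))) (sym (++-assoc pre ms _)))
  ...   | inj₁ (_ ∷ s ∷ S , refl , refl) with ms
  ...     | []    = inj₂ (inj₁ ([] , suf , refl))
  ...     | p ∷ P = inj₂ (inj₂ (p , P , s , S , refl , (pre , refl) , (suf , refl)))

  pair-split : ∀ {u v} X x Y → u ∷ v ∷ [] ⊑ X ++ x ∷ Y →
    u ∷ v ∷ [] ⊑ X ∷ʳ x ⊎ u ∷ v ∷ [] ⊑ x ∷ Y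
  pair-split X x Y uv⊑ with subwalk-split X x Y uv⊑
  ... | inj₁ uv⊑X                                    = inj₁ uv⊑X
  ... | inj₂ (inj₁ uv⊑Y)                             = inj₂ uv⊑Y
  ... | inj₂ (inj₂ (_ , []        , _ , _ , () , _))
  ... | inj₂ (inj₂ (_ , _ ∷ []    , _ , _ , () , _))
  ... | inj₂ (inj₂ (_ , _ ∷ _ ∷ _ , _ , _ , () , _))

  pair-second : ∀ {u v h ys} → u ∷ v ∷ [] ⊑ h ∷ ys → v ∈ ys
  pair-second ([]      , _ , refl) = here refl
  pair-second (_ ∷ pre , _ , refl) = ∈-++⁺ʳ pre (there (here refl))

  pair-first : ∀ {u v} D → u ∷ v ∷ [] ⊑ D ∷ʳ u → u ∈ D
  pair-first D (pre , _ , eq) = ∈-init pre D eq λ ()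

  pair-last : ∀ {u v} D → v ∉ D → u ∷ v ∷ [] ⊑ D ∷ʳ v → ∃[ D₀ ] (D ≡ D₀ ∷ʳ u)
  pair-last {u} D _   (pre , []    , eq) = pre , sym (∷ʳ-injectiveˡ (pre ∷ʳ u) D (trans (++-assoc pre _ _) eq))
  pair-last {u} D v∉D (pre , _ ∷ _ , eq) =
    ⊥-elim (v∉D (∈-init (pre ∷ʳ u) D (trans (∷ʳ-++ pre u _) eq) λ ()))

  pair-head : ∀ {u v γ} → u ∉ γ → u ∷ v ∷ [] ⊑ u ∷ γ → ∃[ s ] (γ ≡ v ∷ s)
  pair-head _   ([]      , s , refl) = s , refl
  pair-head u∉γ (_ ∷ pre , _ , eq)   =
    ⊥-elim (u∉γ (subst (_ ∈_) (∷-injectiveʳ eq) (∈-++⁺ʳ pre (here refl))))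

  -- Unavoidable walks

  unavoidable-⊑ : ∀ {U W} → Unavoidable W → U ⊑ W → Unavoidable U
  unavoidable-⊑ unav U⊑W C closed cover = let k , W⊑ = unav C closed cover in k , ⊑-trans U⊑W W⊑

  rounds : V → List (List V) → List V
  rounds x βs = concat (map (x ∷_) βs)

  rounds-∷ʳ : ∀ x βs → ∃[ Y ] (rounds x βs ∷ʳ x ≡ x ∷ Y)
  rounds-∷ʳ x []       = [] , refl
  rounds-∷ʳ x (β ∷ βs) = _ , refl

  rounds-step : ∀ x β βs → rounds x (β ∷ βs) ∷ʳ x ≡ (x ∷ β) ++ rounds x βs ∷ʳ x
  rounds-step x β βs = ++-assoc (x ∷ β) (rounds x βs) _

  Linked-rounds : ∀ x βs → All (λ β → Linked Arc (x ∷ β ∷ʳ x)) βs → Linked Arc (rounds x βs ∷ʳ x)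
  Linked-rounds x []       []       = [-]
  Linked-rounds x (β ∷ βs) (l ∷ ls) with rounds-∷ʳ x βs
  ... | Y , eq = subst (Linked Arc) (sym (trans (rounds-step x β βs) (cong ((x ∷ β) ++_) eq)))
                   (Linked-glue (x ∷ β) l (subst (Linked Arc) eq (Linked-rounds x βs ls)))

  repeat-rounds : ∀ x βs k → repeat (rounds x βs) k ≡ rounds x (repeat βs k)
  repeat-rounds x βs zero    = refl
  repeat-rounds x βs (suc k) = begin
    rounds x βs ++ repeat (rounds x βs) k                ≡⟨ cong (rounds x βs ++_) (repeat-rounds x βs k) ⟩
    rounds x βs ++ rounds x (repeat βs k)                ≡⟨ concat-++ (map (x ∷_) βs) _ ⟩
    concat (map (x ∷_) βs ++ map (x ∷_) (repeat βs k))   ≡⟨ cong concat (map-++ (x ∷_) βs _) ⟨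
    rounds x (βs ++ repeat βs k)                         ∎
    where open ≡-Reasoning

  closed-walk-cycle : ∀ {C} → IsClosedWalk G C →
    ∃[ c ] ∃[ S ] (take (length C ∸ 1) C ≡ c ∷ S × Linked Arc (c ∷ S ∷ʳ c))
  closed-walk-cycle {c ∷ cs} (w , cs≢[] , last) with loop-view cs≢[] last
  ... | S , eq = c , S , subst (λ C → take (length C ∸ 1) C ≡ c ∷ S) (sym eq) (take-init (c ∷ S)) ,
                 subst (Linked Arc) eq (walk⇒linked w)

  record AvoidingLoop (W : List V) (x v : V) : Set where
    field
      body   : List V
      closed : Linked Arc (x ∷ body ∷ʳ x)
      visits : v ∈ x ∷ body
      skips  : ∀ Y → W ⊑ (x ∷ body) ++ x ∷ Y → W ⊑ x ∷ Y

  -- One loop per node, concatenated, is a covering closed walk; by skips, no power of it contains W.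
  avoidable-by-loops : ∀ {u w W} x → (∀ v → AvoidingLoop (u ∷ w ∷ W) x v) → ¬ Unavoidable (u ∷ w ∷ W)
  avoidable-by-loops {u} {w} {W} x loop unav =
    avoided (repeat βs k) (All.concat⁺ (All.replicate⁺ k skips-βs)) P⊑
    where
    open AvoidingLoop

    P : List V
    P = u ∷ w ∷ W

    Skips : List V → Set
    Skips β = ∀ Y → P ⊑ (x ∷ β) ++ x ∷ Y → P ⊑ x ∷ Y

    avoided : ∀ γs → All Skips γs → ¬ P ⊑ rounds x γs ∷ʳ x
    avoided []       []         = ¬⊑-singleton
    avoided (γ ∷ γs) (sk ∷ sks) P⊑ with rounds-∷ʳ x γs
    ... | Y , eq = avoided γs sks (subst (P ⊑_) (sym eq)
                     (sk Y (subst (P ⊑_) (trans (rounds-step x γ γs) (cong ((x ∷ γ) ++_) eq)) P⊑)))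

    βs : List (List V)
    βs = map (body ∘ loop) (x ∷ allFin n)

    skips-βs : All Skips βs
    skips-βs = All.map⁺ (All.universal (skips ∘ loop) _)

    C : List V
    C = rounds x βs ∷ʳ x

    closed-C : IsClosedWalk G C
    closed-C = linked⇒walk (Linked-rounds x βs (All.map⁺ (All.universal (closed ∘ loop) _))) ,
               ∷ʳ≢[] (body (loop x) ++ rounds x (map (body ∘ loop) (allFin n))) ,
               lastOr-∷ʳ x (body (loop x) ++ rounds x (map (body ∘ loop) (allFin n)))

    cover : Covering G C
    cover v =
      ∈-++⁺ˡ (∈-concat⁺′ (visits (loop v)) (∈-map⁺ (x ∷_) (∈-map⁺ (body ∘ loop) (there (∈-allFin v)))))

    k : ℕ
    k = proj₁ (unav C closed-C cover)

    P⊑ : P ⊑ rounds x (repeat βs k) ∷ʳ x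
    P⊑ = ⊑-++ʳ (x ∷ []) (subst (P ⊑_) (trans (cong (λ T → repeat T k) (take-init (rounds x βs)))
                                              (repeat-rounds x βs k))
                                       (proj₂ (unav C closed-C cover)))

  extend-in-cycle : ∀ {x w W c S} k → Linked Arc (c ∷ S ∷ʳ c) → (∀ {p} → Arc p w → p ≡ x) →
    w ∷ W ⊑ repeat (c ∷ S) k → x ∷ w ∷ W ⊑ repeat (c ∷ S) (suc k)
  extend-in-cycle {x} {w} {W} {c} {S} k cycle only-x (pre , suf , eq) with snoc-last {c} {S ++ pre} refl
  ... | I , I≡ = I , suf , sym (trans unfold (cong (λ p → I ++ p ∷ w ∷ W ++ suf) (only-x p→w)))
    where
    open ≡-Reasoning
    T : List V
    T = c ∷ S
    p : V
    p = lastOr G c (S ++ pre)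
    unfold : T ++ repeat T k ≡ I ++ p ∷ w ∷ W ++ suf
    unfold = begin
      T ++ repeat T k                 ≡⟨ cong (T ++_) eq ⟨
      T ++ pre ++ w ∷ W ++ suf        ≡⟨ ++-assoc T pre _ ⟨
      (T ++ pre) ++ w ∷ W ++ suf      ≡⟨ cong (_++ w ∷ W ++ suf) I≡ ⟨
      (I ∷ʳ p) ++ w ∷ W ++ suf        ≡⟨ ∷ʳ-++ I p _ ⟩
      I ++ p ∷ w ∷ W ++ suf           ∎
    linked : Linked Arc (repeat T (suc k) ∷ʳ c)
    linked = subst (λ Z → Linked Arc (concat Z ∷ʳ c)) (map-replicate (c ∷_) (suc k) S)
               (Linked-rounds c (replicate (suc k) S) (All.replicate⁺ (suc k) cycle))
    p→w : Arc p w
    p→w = Linked.head (Linked-++⁻ʳ I (subst (Linked Arc) (trans (cong (_∷ʳ c) unfold) (++-assoc I _ _)) linked))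

  unavoidable-extendˡ : ∀ {x w W} → Unavoidable (w ∷ W) → (∀ {p} → Arc p w → p ≡ x) →
    Unavoidable (x ∷ w ∷ W)
  unavoidable-extendˡ {x} {w} {W} unav only-x C closed cover with closed-walk-cycle closed | unav C closed cover
  ... | c , S , T≡ , cycle | k , W⊑ =
    suc k , subst (λ T → x ∷ w ∷ W ⊑ repeat T (suc k)) (sym T≡)
              (extend-in-cycle k cycle only-x (subst (λ T → w ∷ W ⊑ repeat T k) T≡ W⊑))

  maximal⇒¬unique-pred : ∀ {y w W} → IsMaximalSafe G (w ∷ W) → Arc y w →
    ¬ (∀ {p} → Arc p w → p ≡ y)
  maximal⇒¬unique-pred {y} {w} {W} ((walk , unav) , maximal) y→w only-y =
    ≢-cons-self (w ∷ W) (maximal (y ∷ w ∷ W) ((y→w , walk) , unavoidable-extendˡ unav only-y)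
                                 (y ∷ [] , [] , cong (y ∷_) (++-identityʳ (w ∷ W))))

  TwoPreds AtMostOnePred : V → Set
  TwoPreds v      = ∃[ p ] ∃[ q ] (Arc p v × Arc q v × p ≢ q)
  AtMostOnePred v = ∀ {p q} → Arc p v → Arc q v → p ≡ q

  preds : V → List V
  preds v = map proj₁ (filter (λ e → proj₂ e ≟ v) G)

  preds? : ∀ v → TwoPreds v ⊎ AtMostOnePred v
  preds? v with all-equal-or-two-distinct _≟_ (preds v)
  ... | inj₁ (p , q , p∈ , q∈ , p≢q) = inj₁ (p , q , ∈preds⇒arc p∈ , ∈preds⇒arc q∈ , p≢q)
    where
    ∈preds⇒arc : ∀ {p} → p ∈ preds v → Arc p v
    ∈preds⇒arc p∈ with ∈-map∘filter⁻ proj₁ (λ e → proj₂ e ≟ v) p∈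
    ... | _ , p→v , refl , refl = p→v
  ... | inj₂ all-equal = inj₂ λ p→v q→v → all-equal (arc⇒∈preds p→v) (arc⇒∈preds q→v)
    where
    arc⇒∈preds : ∀ {p} → Arc p v → p ∈ preds v
    arc⇒∈preds p→v = ∈-map∘filter⁺ proj₁ (λ e → proj₂ e ≟ v) (_ , p→v , refl , refl)

  two⇒¬one : ∀ {v} → TwoPreds v → ¬ AtMostOnePred v
  two⇒¬one (p , q , p→v , q→v , p≢q) one = p≢q (one p→v q→v)

  other-pred : ∀ {a v} → TwoPreds v → ∃[ c ] (c ≢ a × Arc c v)
  other-pred {a} (p , q , p→v , q→v , p≢q) with p ≟ a
  ... | yes refl = q , (p≢q ∘ sym) , q→v
  ... | no p≢a   = p , p≢a , p→v

  ¬⊑-simple-loop : ∀ {a b z N L} → b ∉ L → ¬ a ∷ b ∷ N ∷ʳ z ⊑ b ∷ L ∷ʳ b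
  ¬⊑-simple-loop {a} {b} {z} {N} {L} b∉L (pre , suf , eq) = b∉L (b∈L pre eq)
    where
    R≢[] : N ∷ʳ z ++ suf ≢ []
    R≢[] = ∷ʳ≢[] N ∘ ++-conicalˡ (N ∷ʳ z) suf
    b∈L : ∀ pre → pre ++ a ∷ b ∷ N ∷ʳ z ++ suf ≡ b ∷ L ∷ʳ b → b ∈ L
    b∈L []        eq = ∈-init [] L (∷-injectiveʳ eq) R≢[]
    b∈L (_ ∷ pre) eq = ∈-init (pre ∷ʳ a) L (trans (∷ʳ-++ pre a _) (∷-injectiveʳ eq)) R≢[]

  straddle-at-pivot : ∀ {a b z p s : V} {N P S : List V} → b ∉ N →
    (List V ∋ a ∷ b ∷ N ∷ʳ z) ≡ p ∷ P ++ b ∷ s ∷ S → p ∷ P ≡ a ∷ [] × s ∷ S ≡ N ∷ʳ z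
  straddle-at-pivot {P = []}    _   eq =
    cong (_∷ []) (sym (∷-injectiveˡ eq)) , sym (∷-injectiveʳ (∷-injectiveʳ eq))
  straddle-at-pivot {N = N} {P = _ ∷ P} b∉N eq =
    ⊥-elim (b∉N (∈-init P N (sym (∷-injectiveʳ (∷-injectiveʳ eq))) λ ()))

  pivot-loop-skips : ∀ {a b z N ℓ} → b ∉ N → lastOr G b ℓ ≢ a →
    ¬ a ∷ b ∷ N ∷ʳ z ⊑ b ∷ ℓ ∷ʳ b →
    ∀ Y → a ∷ b ∷ N ∷ʳ z ⊑ (b ∷ ℓ) ++ b ∷ Y → a ∷ b ∷ N ∷ʳ z ⊑ b ∷ Y
  pivot-loop-skips {b = b} {ℓ = ℓ} b∉N last≢a avoids Y P⊑ with subwalk-split (b ∷ ℓ) b Y P⊑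
  ... | inj₁ P⊑loop     = ⊥-elim (avoids P⊑loop)
  ... | inj₂ (inj₁ P⊑Y) = P⊑Y
  ... | inj₂ (inj₂ (_ , _ , _ , _ , eq , (X₀ , X≡) , _)) =
    ⊥-elim (last≢a (∷≡∷ʳ⇒lastOr X₀
      (trans X≡ (cong (X₀ ++_) (proj₁ (straddle-at-pivot b∉N eq))))))

  -- Each loop at b finally enters b from a node other than a: a return loop ending in a is extended
  -- by a fixed walk ω from b to c.  So a b N z occurs only inside such an extended loop, with N z a
  -- prefix of ω b, which holds for at most one z.
  two-continuations-avoidable : StronglyConnected G → ∀ {a b c y y′ : V} {N : List V} →
    c ≢ a → Arc c b → b ∉ N → y ≢ y′ →
    Unavoidable (a ∷ b ∷ N ∷ʳ y) → Unavoidable (a ∷ b ∷ N ∷ʳ y′) → ⊥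
  two-continuations-avoidable sc {a} {b} {c} {y} {y′} {N} c≢a c→b b∉N y≢y′ unav unav′
    with last-visit _ (proj₂ (reach⇒path sc b c))
  ... | ω , b∉ω , pω = avoidable-by-loops b (loops y ¬continues-y) unav
    where
    Continues : V → Set
    Continues z = ∃[ Y₀ ] (ω ∷ʳ b ≡ N ∷ʳ z ++ Y₀)

    continues-unique : Continues y → Continues y′ → y ≡ y′
    continues-unique (Y₀ , e) (Y₀′ , e′) =
      ∷-injectiveˡ (++-cancelˡ N _ _
        (trans (sym (∷ʳ-++ N y Y₀)) (trans (sym e) (trans e′ (∷ʳ-++ N y′ Y₀′)))))

    loops : ∀ z → ¬ Continues z → ∀ v → AvoidingLoop (a ∷ b ∷ N ∷ʳ z) b v
    loops z ¬cont v with return-loop sc c→b v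
    ... | L , b∉L , closed-L , v∈ with lastOr G b L ≟ a
    ...   | no last≢a = record
            { body = L ; closed = closed-L ; visits = v∈
            ; skips = pivot-loop-skips b∉N last≢a (¬⊑-simple-loop b∉L) }
    ...   | yes _ = record
            { body   = L ++ b ∷ ω
            ; closed = subst (Linked Arc) (sym split) (Linked-glue (b ∷ L) closed-L (close-path pω c→b))
            ; visits = ∈-++⁺ˡ v∈
            ; skips  = pivot-loop-skips b∉N last≢a avoids }
      where
      split : b ∷ (L ++ b ∷ ω) ∷ʳ b ≡ (b ∷ L) ++ b ∷ ω ∷ʳ b
      split = cong (b ∷_) (++-assoc L (b ∷ ω) _)
      last≢a : lastOr G b (L ++ b ∷ ω) ≢ a
      last≢a = c≢a ∘ trans (sym (trans (lastOr-++ b L (b ∷ ω)) (proj₂ pω)))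
      avoids : ¬ a ∷ b ∷ N ∷ʳ z ⊑ b ∷ (L ++ b ∷ ω) ∷ʳ b
      avoids P⊑ with subwalk-split (b ∷ L) b (ω ∷ʳ b) (subst (a ∷ b ∷ N ∷ʳ z ⊑_) split P⊑)
      ... | inj₁ P⊑L        = ¬⊑-simple-loop b∉L P⊑L
      ... | inj₂ (inj₁ P⊑ω) = ¬⊑-simple-loop b∉ω P⊑ω
      ... | inj₂ (inj₂ (_ , _ , _ , _ , eq , _ , Y₀ , Y≡)) =
            ¬cont (Y₀ , trans Y≡ (cong (_++ Y₀) (proj₂ (straddle-at-pivot b∉N eq))))

    ¬continues-y : ¬ Continues y
    ¬continues-y cont = avoidable-by-loops b (loops y′ (y≢y′ ∘ continues-unique cont)) unav′

  -- Keys of maximal safe walks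

  BackChain : V → List V → Set
  BackChain x []       = ⊤
  BackChain x (p ∷ ps) = Arc p x × AtMostOnePred x × BackChain p ps

  backChain-∷ʳ : ∀ x ps {y} → BackChain x ps → Arc y (lastOr G x ps) → AtMostOnePred (lastOr G x ps) →
    BackChain x (ps ∷ʳ y)
  backChain-∷ʳ x []       _                 y→ one = y→ , one , tt
  backChain-∷ʳ x (p ∷ ps) (p→x , onex , bc) y→ one = p→x , onex , backChain-∷ʳ p ps bc y→ one

  backChain-comparable : ∀ x ps qs → BackChain x ps → BackChain x qs →
    ps ≡ qs ⊎ (∃[ y ] ∃[ T ] (ps ≡ qs ++ y ∷ T)) ⊎ (∃[ y ] ∃[ T ] (qs ≡ ps ++ y ∷ T))
  backChain-comparable x []       []       _ _ = inj₁ refl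
  backChain-comparable x []       (q ∷ qs) _ _ = inj₂ (inj₂ (q , qs , refl))
  backChain-comparable x (p ∷ ps) []       _ _ = inj₂ (inj₁ (p , ps , refl))
  backChain-comparable x (p ∷ ps) (q ∷ qs) (p→x , one , bc) (q→x , _ , bc′) with one p→x q→x
  ... | refl with backChain-comparable p ps qs bc bc′
  ...   | inj₁ refl                  = inj₁ refl
  ...   | inj₂ (inj₁ (y , T , refl)) = inj₂ (inj₁ (y , T , refl))
  ...   | inj₂ (inj₂ (y , T , refl)) = inj₂ (inj₂ (y , T , refl))

  backChain-of-walk : ∀ w I → Linked Arc (w ∷ I) → All AtMostOnePred I →
    ∃[ ps ] (reverse (w ∷ I) ≡ lastOr G w I ∷ ps × BackChain (lastOr G w I) ps)
  backChain-of-walk w []      _         _            = [] , refl , tt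
  backChain-of-walk w (x ∷ I) (w→x ∷ l) (onex ∷ one) with backChain-of-walk x I l one
  ... | ps , eq , bc = ps ∷ʳ w , trans (unfold-reverse w (x ∷ I)) (cong (_∷ʳ w) eq) ,
                       backChain-∷ʳ _ ps bc (subst (Arc w) (sym x≡) w→x) (subst AtMostOnePred (sym x≡) onex)
    where
    x≡ : lastOr G (lastOr G x I) ps ≡ x
    x≡ = ∷≡∷ʳ⇒lastOr (reverse I) (trans (sym eq) (unfold-reverse x I))

  unreverse : ∀ {xs ys : List V} {y T} → reverse xs ≡ reverse ys ++ y ∷ T → xs ≡ reverse T ++ y ∷ ys
  unreverse {xs} {ys} {y} {T} eq = begin
    xs                                       ≡⟨ reverse-involutive xs ⟨
    reverse (reverse xs)                     ≡⟨ cong reverse eq ⟩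
    reverse (reverse ys ++ y ∷ T)            ≡⟨ reverse-++ (reverse ys) (y ∷ T) ⟩
    reverse (y ∷ T) ++ reverse (reverse ys)  ≡⟨ cong₂ _++_ (unfold-reverse y T) (reverse-involutive ys) ⟩
    reverse T ∷ʳ y ++ ys                     ≡⟨ ∷ʳ-++ (reverse T) y ys ⟩
    reverse T ++ y ∷ ys                      ∎
    where open ≡-Reasoning

  walks-into-comparable : ∀ {w I w′ I′} → Linked Arc (w ∷ I) → Linked Arc (w′ ∷ I′) →
    All AtMostOnePred I → All AtMostOnePred I′ → lastOr G w I ≡ lastOr G w′ I′ →
    w ∷ I ≡ w′ ∷ I′ ⊎
    (∃[ B ] ∃[ y ] (w ∷ I ≡ B ++ y ∷ w′ ∷ I′)) ⊎ (∃[ B ] ∃[ y ] (w′ ∷ I′ ≡ B ++ y ∷ w ∷ I))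
  walks-into-comparable {w} {I} {w′} {I′} l l′ one one′ same-end
    with backChain-of-walk w I l one | backChain-of-walk w′ I′ l′ one′
  ... | ps , eq , bc | qs , eq′ , bc′
    with backChain-comparable _ ps qs bc (subst (λ x → BackChain x qs) (sym same-end) bc′)
  ...   | inj₁ refl = inj₁ (reverse-injective (trans eq (trans (cong (_∷ ps) same-end) (sym eq′))))
  ...   | inj₂ (inj₁ (y , T , refl)) = inj₂ (inj₁ (reverse T , y ,
          unreverse (trans eq (trans (cong (λ x → x ∷ qs ++ y ∷ T) same-end)
                                     (cong (_++ y ∷ T) (sym eq′))))))
  ...   | inj₂ (inj₂ (y , T , refl)) = inj₂ (inj₂ (reverse T , y ,
          unreverse (trans eq′ (trans (cong (λ x → x ∷ ps ++ y ∷ T) (sym same-end))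
                                      (cong (_++ y ∷ T) (sym eq))))))

  ¬maximal-proper-suffix : ∀ {w I w′ I′ B y X Y} → Linked Arc (w ∷ I ++ X) → All AtMostOnePred I →
    w ∷ I ≡ B ++ y ∷ w′ ∷ I′ → ¬ IsMaximalSafe G (w′ ∷ I′ ++ Y)
  ¬maximal-proper-suffix {w} {I} {w′} {I′} {B} {y} {X} l one eq m′ =
    maximal⇒¬unique-pred m′ y→w′ λ p→w′ → All.lookup one (∈-after B eq) p→w′ y→w′
    where
    y→w′ : Arc y w′
    y→w′ = Linked.head (Linked-++⁻ʳ B (subst (Linked Arc) (trans (cong (_++ X) eq) (++-assoc B _ X)) l))

  record PivotSplit (W : List V) : Set where
    field
      first pivot : V
      inner rest  : List V
      shape       : W ≡ first ∷ inner ++ pivot ∷ rest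
      inner-one   : All AtMostOnePred inner
      pivot-two   : rest ≡ [] ⊎ TwoPreds pivot

    key : V × V
    key = lastOr G first inner , pivot

  pivot-split : ∀ {W} → 2 ≤ length W → PivotSplit W
  pivot-split {_ ∷ []}     (s≤s ())
  pivot-split {w ∷ x ∷ xs} _ = split w x xs
    where
    split : ∀ w x rest → PivotSplit (w ∷ x ∷ rest)
    split w x [] = record
      { first = w ; pivot = x ; inner = [] ; rest = [] ; shape = refl ; inner-one = [] ; pivot-two = inj₁ refl }
    split w x (y ∷ r) with preds? x
    ... | inj₁ two = record
      { first = w ; pivot = x ; inner = [] ; rest = y ∷ r ; shape = refl ; inner-one = [] ; pivot-two = inj₂ two }
    ... | inj₂ one = let open PivotSplit (split x y r) in record
      { first = w ; pivot = pivot ; inner = first ∷ inner ; rest = rest ; shape = cong (w ∷_) shape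
      ; inner-one = subst AtMostOnePred (∷-injectiveˡ shape) one ∷ inner-one ; pivot-two = pivot-two }

  key-unavoidable : ∀ {W} → IsMaximalSafe G W → (s : PivotSplit W) →
    Unavoidable (proj₁ (PivotSplit.key s) ∷ proj₂ (PivotSplit.key s) ∷ [])
  key-unavoidable ((_ , unav) , _) record { first = w ; inner = I ; pivot = b ; rest = R ; shape = refl }
    with snoc-last {w} {I} refl
  ... | X , X≡ = unavoidable-⊑ unav (X , R , trans (sym (∷ʳ-++ X _ (b ∷ R))) (cong (_++ b ∷ R) X≡))

  ⊑-through-pivot : ∀ A₀ {b Q D b₂ N E a₂ y t} → b ∷ Q ≡ D ++ b₂ ∷ N → E ∷ʳ a₂ ≡ A₀ ++ D →
    a₂ ∷ b₂ ∷ N ∷ʳ y ⊑ A₀ ++ b ∷ Q ++ y ∷ t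
  ⊑-through-pivot A₀ {b} {Q} {D} {b₂} {N} {E} {a₂} {y} {t} Q≡ E≡ = E , t , (begin
    E ++ a₂ ∷ b₂ ∷ N ∷ʳ y ++ t      ≡⟨ cong (λ Z → E ++ a₂ ∷ b₂ ∷ Z) (∷ʳ-++ N y t) ⟩
    E ++ a₂ ∷ b₂ ∷ N ++ y ∷ t       ≡⟨ ∷ʳ-++ E a₂ _ ⟨
    E ∷ʳ a₂ ++ b₂ ∷ N ++ y ∷ t      ≡⟨ cong (_++ b₂ ∷ N ++ y ∷ t) E≡ ⟩
    (A₀ ++ D) ++ b₂ ∷ N ++ y ∷ t    ≡⟨ ++-assoc A₀ D _ ⟩
    A₀ ++ D ++ b₂ ∷ N ++ y ∷ t      ≡⟨ cong (A₀ ++_) (++-assoc D (b₂ ∷ N) (y ∷ t)) ⟨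
    A₀ ++ (D ++ b₂ ∷ N) ++ y ∷ t    ≡⟨ cong (λ Z → A₀ ++ Z ++ y ∷ t) Q≡ ⟨
    A₀ ++ b ∷ Q ++ y ∷ t            ∎)
    where open ≡-Reasoning

  maximal-suffix-determined : StronglyConnected G → ∀ {w I b R R′} →
    IsMaximalSafe G (w ∷ I ++ b ∷ R) → IsMaximalSafe G (w ∷ I ++ b ∷ R′) → R ≡ [] ⊎ TwoPreds b →
    w ∷ I ++ b ∷ R ≡ w ∷ I ++ b ∷ R′
  maximal-suffix-determined sc {w} {I} {b} {R} {R′} m m′ end with prefix-or-diverge _≟_ R R′
  ... | inj₁ (zs , refl)        = proj₂ m _ (proj₁ m′) ([] , zs , ++-assoc (w ∷ I) (b ∷ R) zs)
  ... | inj₂ (inj₁ (zs , refl)) = sym (proj₂ m′ _ (proj₁ m) ([] , zs , ++-assoc (w ∷ I) (b ∷ R′) zs))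
  ... | inj₂ (inj₂ (Q , y , y′ , t , t′ , y≢y′ , refl , refl)) with split-at-last preds? (b ∷ Q)
  ...   | inj₂ (one ∷ _) = ⊥-elim (two⇒¬one two one)
    where
    two : TwoPreds b
    two = [ (λ ()) ∘ ++-conicalʳ Q _ , id ]′ end
  ...   | inj₁ (D , b₂ , N , Q≡ , two₂ , oneN) with snoc-last {w} {I ++ D} refl | other-pred two₂
  ...     | E , E≡ | c , c≢a₂ , c→b₂ =
    ⊥-elim (two-continuations-avoidable sc c≢a₂ c→b₂ (two⇒¬one two₂ ∘ All.lookup oneN) y≢y′
             (unavoidable-⊑ (proj₂ (proj₁ m))  (⊑-through-pivot (w ∷ I) Q≡ E≡))
             (unavoidable-⊑ (proj₂ (proj₁ m′)) (⊑-through-pivot (w ∷ I) Q≡ E≡)))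

  pivot-split-injective : StronglyConnected G → ∀ {W W′} → IsMaximalSafe G W → IsMaximalSafe G W′ →
    (s : PivotSplit W) (s′ : PivotSplit W′) → PivotSplit.key s ≡ PivotSplit.key s′ → W ≡ W′
  pivot-split-injective sc m m′
    record { first = w  ; inner = I  ; pivot = b  ; rest = R  ; shape = refl ; inner-one = one  ; pivot-two = end }
    record { first = w′ ; inner = I′ ; pivot = b′ ; rest = R′ ; shape = refl ; inner-one = one′ }
    same-key with cong proj₂ same-key
  ... | refl with walks-into-comparable (Linked-++⁻ˡ (w ∷ I) (maximal⇒linked m))
                                        (Linked-++⁻ˡ (w′ ∷ I′) (maximal⇒linked m′))
                                        one one′ (cong proj₁ same-key)
  ...   | inj₁ refl                = maximal-suffix-determined sc m m′ end
  ...   | inj₂ (inj₁ (_ , _ , eq)) = ⊥-elim (¬maximal-proper-suffix (maximal⇒linked m) one eq m′)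
  ...   | inj₂ (inj₂ (_ , _ , eq)) = ⊥-elim (¬maximal-proper-suffix (maximal⇒linked m′) one′ eq m)

  -- Arcs on all paths through a root

  module _ (sc : StronglyConnected G) (r : V) where

    OnAllPathsFromRoot OnAllPathsToRoot : V → V → Set
    OnAllPathsFromRoot u v = ∃[ t ] (∀ xs → Path r t xs → u ∷ v ∷ [] ⊑ r ∷ xs)
    OnAllPathsToRoot   u v = ∃[ t ] (∀ xs → Path t r xs → u ∷ v ∷ [] ⊑ t ∷ xs)

    OnAllPaths : V × V → Set
    OnAllPaths (u , v) = OnAllPathsFromRoot u v ⊎ OnAllPathsToRoot u v

    from-root⇒paths-to-head : ∀ {u v} → OnAllPathsFromRoot u v →
      ∀ xs → Path r v xs → u ∷ v ∷ [] ⊑ r ∷ xs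
    from-root⇒paths-to-head {u} {v} (t , on-all) xs pxs
      with last-visit _ (proj₂ (reach⇒path sc v t)) | snoc-last (proj₂ pxs)
    ... | δ , v∉δ , pδ | X , X≡
      with pair-split X v δ (subst (u ∷ v ∷ [] ⊑_) (trans (cong (_++ δ) (sym X≡)) (∷ʳ-++ X v δ))
                                   (on-all (xs ++ δ) (path-++ pxs pδ)))
    ...   | inj₁ uv⊑ = subst (u ∷ v ∷ [] ⊑_) X≡ uv⊑
    ...   | inj₂ uv⊑ = ⊥-elim (v∉δ (pair-second uv⊑))

    from-root-tail-unique : ∀ {u u′ v} → OnAllPathsFromRoot u v → OnAllPathsFromRoot u′ v → u ≡ u′
    from-root-tail-unique {v = v} F F′ with first-visit _ (proj₂ (reach⇒path sc r v))
    ... | D , ys , v∉D , eq , pys with last-before-v F | last-before-v F′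
      where
      last-before-v : ∀ {u} → OnAllPathsFromRoot u v → ∃[ D₀ ] (D ≡ D₀ ∷ʳ u)
      last-before-v {u} F = pair-last D v∉D (subst (u ∷ v ∷ [] ⊑_) eq (from-root⇒paths-to-head F ys pys))
    ...   | D₀ , e | D₀′ , e′ = ∷ʳ-injectiveʳ D₀ D₀′ (trans (sym e) e′)

    to-root⇒paths-from-tail : ∀ {u v} → OnAllPathsToRoot u v →
      ∀ xs → Path u r xs → u ∷ v ∷ [] ⊑ u ∷ xs
    to-root⇒paths-from-tail {u} {v} (t , on-all) xs pxs with first-visit _ (proj₂ (reach⇒path sc t u))
    ... | D , ys , u∉D , eq , pys
      with pair-split D u xs (subst (u ∷ v ∷ [] ⊑_) (trans (cong (_++ xs) eq) (∷ʳ-++ D u xs))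
                                    (on-all (ys ++ xs) (path-++ pys pxs)))
    ...   | inj₁ uv⊑ = ⊥-elim (u∉D (pair-first D uv⊑))
    ...   | inj₂ uv⊑ = uv⊑

    to-root-head-unique : ∀ {u v v′} → OnAllPathsToRoot u v → OnAllPathsToRoot u v′ → v ≡ v′
    to-root-head-unique {u} B B′ with last-visit _ (proj₂ (reach⇒path sc u r))
    ... | γ , u∉γ , pγ
      with pair-head u∉γ (to-root⇒paths-from-tail B γ pγ) | pair-head u∉γ (to-root⇒paths-from-tail B′ γ pγ)
    ...   | _ , e | _ , e′ = ∷-injectiveˡ (trans (sym e) e′)

    from-root to-root : Fin 2
    from-root = zero
    to-root   = suc zero

    arc-code : ∀ k → OnAllPaths k → Fin (2 * n)
    arc-code (u , v) (inj₁ _) = combine from-root v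
    arc-code (u , v) (inj₂ _) = combine to-root u

    arc-code-injective : ∀ k k′ (c : OnAllPaths k) (c′ : OnAllPaths k′) →
      arc-code k c ≡ arc-code k′ c′ → k ≡ k′
    arc-code-injective (u , v) (u′ , v′) (inj₁ f) (inj₁ f′) eq
      with combine-injective from-root v from-root v′ eq
    ... | _ , refl = cong (_, v) (from-root-tail-unique f f′)
    arc-code-injective (u , v) (u′ , v′) (inj₂ b) (inj₂ b′) eq
      with combine-injective to-root u to-root u′ eq
    ... | _ , refl = cong (u ,_) (to-root-head-unique b b′)
    arc-code-injective (u , v) (u′ , v′) (inj₁ _) (inj₂ _) eq
      with combine-injective from-root v to-root u′ eq
    ... | () , _
    arc-code-injective (u , v) (u′ , v′) (inj₂ _) (inj₁ _) eq
      with combine-injective to-root u from-root v′ eq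
    ... | () , _

    -- Only double-negated: deciding between the two cases quantifies over all paths.  The loop
    -- through r itself is borrowed from t₀.
    unavoidable⇒on-all-paths : ∀ {t₀} → t₀ ≢ r → ∀ {u v} → Unavoidable (u ∷ v ∷ []) →
      ¬ ¬ OnAllPaths (u , v)
    unavoidable⇒on-all-paths {t₀} t₀≢r {u} {v} unav ¬on =
      Fin.sequence ¬¬-applicative avoid-from λ from →
      Fin.sequence ¬¬-applicative avoid-to   λ to →
      avoidable-by-loops r (loop from to) unav
      where
      uv : List V
      uv = u ∷ v ∷ []

      AvoidFrom AvoidTo : V → Set
      AvoidFrom t = ∃[ xs ] (Path r t xs × ¬ uv ⊑ r ∷ xs)
      AvoidTo   t = ∃[ xs ] (Path t r xs × ¬ uv ⊑ t ∷ xs)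

      avoid-from : ∀ t → ¬ ¬ AvoidFrom t
      avoid-from t ¬av =
        ¬on (inj₁ (t , λ xs p → decidable-stable (subwalk? uv (r ∷ xs)) (λ ¬s → ¬av (xs , p , ¬s))))

      avoid-to : ∀ t → ¬ ¬ AvoidTo t
      avoid-to t ¬av =
        ¬on (inj₂ (t , λ xs p → decidable-stable (subwalk? uv (t ∷ xs)) (λ ¬s → ¬av (xs , p , ¬s))))

      round-trip : ∀ {t} → t ≢ r → AvoidFrom t → AvoidTo t → AvoidingLoop uv r t
      round-trip t≢r ([] , (_ , r≡t) , _) _ = ⊥-elim (t≢r (sym r≡t))
      round-trip {t} t≢r (g@(_ ∷ _) , pg , ¬g) (h , ph , ¬h)
        with loop-view (λ ()) (proj₂ (path-++ pg ph)) | snoc-last (proj₂ pg)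
      ... | β , eq | X , X≡ = record
        { body   = β
        ; closed = subst (Linked Arc) eq (proj₁ (path-++ pg ph))
        ; visits = visits
        ; skips  = skips }
        where
        avoids : ¬ uv ⊑ r ∷ g ++ h
        avoids uv⊑ with pair-split X t h (subst (uv ⊑_) (trans (cong (_++ h) (sym X≡)) (∷ʳ-++ X t h)) uv⊑)
        ... | inj₁ uv⊑g = ¬g (subst (uv ⊑_) X≡ uv⊑g)
        ... | inj₂ uv⊑h = ¬h uv⊑h
        visits : t ∈ r ∷ β
        visits with ∈-++⁻ (r ∷ β) (subst (t ∈_) eq (∈-++⁺ˡ (subst (_∈ r ∷ g) (proj₂ pg) (lastOr-∈ r g))))
        ... | inj₁ t∈         = t∈
        ... | inj₂ (here t≡r) = ⊥-elim (t≢r t≡r)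
        skips : ∀ Y → uv ⊑ (r ∷ β) ++ r ∷ Y → uv ⊑ r ∷ Y
        skips Y uv⊑ with pair-split (r ∷ β) r Y uv⊑
        ... | inj₁ uv⊑loop = ⊥-elim (avoids (subst (uv ⊑_) (sym eq) uv⊑loop))
        ... | inj₂ uv⊑Y    = uv⊑Y

      loop : (∀ t → AvoidFrom t) → (∀ t → AvoidTo t) → ∀ t → AvoidingLoop uv r t
      loop from to t with t ≟ r
      ... | no t≢r   = round-trip t≢r (from t) (to t)
      ... | yes refl = let open AvoidingLoop (round-trip t₀≢r (from t₀) (to t₀)) in
                       record { body = body ; closed = closed ; visits = here refl ; skips = skips }

maximal-safe-walks≤ : ∀ {n} (G : Graph n) → StronglyConnected G → ∀ {ws} → Unique ws →
  All (λ W → IsMaximalSafe G W × 2 ≤ length W) ws → length ws ≤ 2 * n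
maximal-safe-walks≤ {zero} G sc {[]}           _ _              = z≤n
maximal-safe-walks≤ {zero} G sc {[] ∷ _}       _ ((_ , ()) ∷ _)
maximal-safe-walks≤ {zero} G sc {(() ∷ _) ∷ _} _ _
maximal-safe-walks≤ {suc zero} G sc u al =
  ≤-trans (length≤-by-injection {P = Split} (λ _ → zero) split-injective u (All.map (map₂ (pivot-split G)) al))
          (s≤s z≤n)
  where
  Split : List (Fin 1) → Set
  Split W = IsMaximalSafe G W × PivotSplit G W

  single-key : (k k′ : Fin 1 × Fin 1) → k ≡ k′
  single-key (zero , zero) (zero , zero) = refl

  split-injective : ∀ {W W′} (s : Split W) (s′ : Split W′) → zero ≡ zero → W ≡ W′
  split-injective (m , s) (m′ , s′) _ = pivot-split-injective G sc m m′ s s′ (single-key _ _)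
maximal-safe-walks≤ {n@(suc (suc _))} G sc {ws} u al =
  decidable-stable (length ws ≤? 2 * n) λ ¬bound →
    All.mapA _ ¬¬-applicative classify (All.map (map₂ (pivot-split G)) al)
      (¬bound ∘ length≤-by-injection code code-injective u)
  where
  r t₀ : Fin n
  r  = zero
  t₀ = suc zero

  Classified : List (Fin n) → Set
  Classified W = IsMaximalSafe G W × Σ (PivotSplit G W) (OnAllPaths G sc r ∘ PivotSplit.key)

  classify : ∀ {W} → IsMaximalSafe G W × PivotSplit G W → ¬ ¬ Classified W
  classify (m , s) =
    ¬¬-map (λ c → m , s , c) (unavoidable⇒on-all-paths G sc r {t₀} (λ ()) (key-unavoidable G m s))

  code : ∀ {W} → Classified W → Fin (2 * n)
  code (_ , s , c) = arc-code G sc r (PivotSplit.key s) c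

  code-injective : ∀ {W W′} (c : Classified W) (c′ : Classified W′) → code c ≡ code c′ → W ≡ W′
  code-injective (m , s , c) (m′ , s′ , c′) eq =
    pivot-split-injective G sc m m′ s s′ (arc-code-injective G sc r _ _ c c′ eq)

lemma21 : ∃[ c ] (∀ (n : ℕ) (G : Graph n) → StronglyConnected G → ¬ IsCycle G →
            (ws : List (List (Fin n))) → Unique ws →
            All (λ W → IsMaximalSafe G W × IsInterleaved G W) ws →
            length ws ≤ c * n)
lemma21 = 2 , λ n G sc _ ws u al → maximal-safe-walks≤ G sc u (All.map (map₂ proj₁) al)
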